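{- Let $M(2)$ be the graph with two vertices $1,2$ joined by an edge. Let $b\ge1$, $c=b+2$, and let $\pi_1,\dots,\pi_p$ be permutations of the vertices of $M(2)$ with $b$ blank spaces. If $p < \binom{c}{2}$, then there exist permutations $\pi_1',\dots,\pi_p'$ of the vertices of $M(2)$ with $b-1$ blank spaces such that for all $i,j$, if $\pi_i$ and $\pi_j$ are $M(2)$-different then $\pi_i'$ and $\pi_j'$ are $M(2)$-different (that is, $H_{\mathcal{F},M(2)}$ is a subgraph of $H_{\mathcal{F}',M(2)}$ under $\pi_i\mapsto\pi_i'$, where $\mathcal{F}=\{\pi_1,\dots,\pi_p\}$ and $\mathcal{F}'=\{\pi_1',\dots,\pi_p'\}$).
   Context: For a finite graph $G$ with $n$ vertices and an integer $b\ge 0$, a permutation of the vertices of $G$ with $b$ blank spaces is a sequence of length $n+b$ in which every vertex of $G$ appears exactly once and the remaining $b$ entries are a blank symbol $*$. Two such sequences $\pi,\sigma$ are $G$-different if there is a position $i$ such that $\pi(i),\sigma(i)$ are both vertices and $\{\pi(i),\sigma(i)\}$ is an edge of $G$. For a family $\mathcal{F}$ of such sequences, $H_{\mathcal{F},G}$ is the graph whose vertices are the members of $\mathcal{F}$, two being adjacent iff they are $G$-different. -}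

module Defs where

open import Data.Nat using (ℕ; _+_)
open import Data.Fin using (Fin; zero; suc)
open import Data.Maybe using (Maybe; just; nothing)
open import Data.Product using (Σ; _×_; ∃; ∃-syntax; _,_; proj₁)
open import Relation.Binary.PropositionalEquality using (_≡_)
open import Relation.Nullary using (¬_)
open import Level using (0ℓ)

record Graph (n : ℕ) : Set₁ where
  field
    Adj   : Fin n → Fin n → Set
    sym   : ∀ {u v} → Adj u v → Adj v u
    irrefl : ∀ {u} → ¬ Adj u u

open Graph public

-- A sequence of length n + b whose entries are vertices (just v) or the
-- blank symbol * (nothing).
Seq : ℕ → ℕ → Set
Seq n b = Fin (n + b) → Maybe (Fin n)

-- It is a permutation of the vertices with b blank spaces iff every vertex
-- appears exactly once (the remaining b entries are then blanks).
IsPermBlanks : (n b : ℕ) → Seq n b → Set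
IsPermBlanks n b s =
  (v : Fin n) → ∃[ i ] ((s i ≡ just v) × ((j : Fin (n + b)) → s j ≡ just v → j ≡ i))

PermBlanks : ℕ → ℕ → Set
PermBlanks n b = Σ (Seq n b) (IsPermBlanks n b)

GDifferent : {n b : ℕ} → Graph n → PermBlanks n b → PermBlanks n b → Set
GDifferent {n} {b} G π σ =
  ∃[ i ] ∃[ u ] ∃[ v ] ((proj₁ π i ≡ just u) × (proj₁ σ i ≡ just v) × Adj G u v)

M2Adj : Fin 2 → Fin 2 → Set
M2Adj u v = ¬ (u ≡ v)

M2 : Graph 2
M2 = record
  { Adj = M2Adj
  ; sym = λ ne eq → ne (Relation.Binary.PropositionalEquality.sym eq)
  ; irrefl = λ ne → ne Relation.Binary.PropositionalEquality.refl
  }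

module Submission where

-- A permutation of the two vertices of M(2) with b+1 blanks
-- is determined by its two occupied slots, an ordered pair of distinct
-- positions among c = b+3 (the paper's c = b'+2 for b' = b+1 blanks).
-- There are (c choose 2) unordered pairs of distinct positions, so when
-- p < (c choose 2) some unordered pair {a,a'}
-- is the slot pair of none of the π_i.  Merging position a' into position a
-- ("gluing") maps the c positions onto c-1 positions, injectively except
-- that a and a' collide; hence it keeps the two slots of every π_i apart,
-- and moving every vertex along the gluing map yields permutations π_i'
-- with b blanks.  Two permutations that had adjacent vertices in a common
-- position still have them in a common (glued) position, so every
-- M(2)-difference survives.

open import Defs hiding (sym)
open import Data.Nat using (ℕ; suc; _+_; _<_)
open import Data.Nat.Combinatorics using (_C_)
open import Data.Fin using (Fin)
open import Data.Product using (Σ)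

open import Data.Nat using (zero; z≤n; s≤s)
open import Data.Nat.Properties using (+-comm; <-irrefl; <-asym)
open import Data.Nat.Combinatorics using (nC1≡n; nCk+nC[k+1]≡[n+1]C[k+1])
open import Data.Fin using (zero; suc; toℕ; splitAt; join; punchOut; _≟_) renaming (_<_ to _<ᶠ_)
open import Data.Fin.Properties
  using (pigeonhole; punchOut-injective; join-splitAt; any?; all?; ¬∀⟶∃¬; suc-injective)
open import Data.Product using (_×_; _,_; proj₁; proj₂; ∃-syntax; swap)
import Data.Product as Product
open import Data.Product.Properties using (≡-dec)
open import Data.Sum using (_⊎_; inj₁; inj₂; [_,_]′)
open import Data.Maybe using (Maybe; just; nothing)
open import Data.Maybe.Properties using (just-injective)
open import Data.Empty using (⊥; ⊥-elim)
open import Function using (_∘_)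
open import Function.Definitions using (Injective)
open import Relation.Nullary using (¬_; Dec; yes; no)
open import Relation.Nullary.Decidable using (_⊎-dec_)
open import Relation.Binary.PropositionalEquality
  using (_≡_; _≢_; refl; sym; trans; cong; cong₂; subst)

module _ {n b : ℕ} (π : PermBlanks n b) where

  position : Fin n → Fin (n + b)
  position v = proj₁ (proj₂ π v)

  position-spec : (v : Fin n) → proj₁ π (position v) ≡ just v
  position-spec v = proj₁ (proj₂ (proj₂ π v))

  position-unique : (v : Fin n) (j : Fin (n + b)) → proj₁ π j ≡ just v → j ≡ position v
  position-unique v = proj₂ (proj₂ (proj₂ π v))

  position-injective : Injective _≡_ _≡_ position
  position-injective {v} {w} e =
    just-injective (trans (sym (position-spec v)) (trans (cong (proj₁ π) e) (position-spec w)))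

module _ {n b : ℕ} (e : Fin n → Fin (n + b)) (e-inj : Injective _≡_ _≡_ e) where

  occupant : {j : Fin (n + b)} → Dec (∃[ v ] e v ≡ j) → Maybe (Fin n)
  occupant (yes (v , _)) = just v
  occupant (no _)        = nothing

  placement : Seq n b
  placement j = occupant (any? (λ v → e v ≟ j))

  placement-spec : (v : Fin n) → placement (e v) ≡ just v
  placement-spec v with any? (λ w → e w ≟ e v)
  ... | yes (w , ew≡ev) = cong just (e-inj ew≡ev)
  ... | no none         = ⊥-elim (none (v , refl))

  placement-unique : (v : Fin n) (j : Fin (n + b)) → placement j ≡ just v → j ≡ e v
  placement-unique v j holds with any? (λ w → e w ≟ j)
  placement-unique v j refl | yes (.v , ev≡j) = sym ev≡j

  fromPositions : PermBlanks n b
  fromPositions = placement , λ v → e v , placement-spec v , placement-unique v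

-- G-differences survive any map g of positions that moves every vertex of
-- π (resp. σ) to its position in π′ (resp. σ′): the common position k of the
-- two adjacent vertices is sent to a common position g k.
relabel-preserves : {n b b′ : ℕ} (G : Graph n) {π σ : PermBlanks n b} {π′ σ′ : PermBlanks n b′}
  (g : Fin (n + b) → Fin (n + b′)) →
  ((v : Fin n) → proj₁ π′ (g (position π v)) ≡ just v) →
  ((v : Fin n) → proj₁ σ′ (g (position σ v)) ≡ just v) →
  GDifferent G π σ → GDifferent G π′ σ′
relabel-preserves G {π} {σ} {π′} {σ′} g moved-π moved-σ (k , u , v , πk≡u , σk≡v , adj) =
  g k , u , v , π′-at-gk , σ′-at-gk , adj
  where
  π′-at-gk : proj₁ π′ (g k) ≡ just u
  π′-at-gk = subst (λ j → proj₁ π′ (g j) ≡ just u) (sym (position-unique π u k πk≡u)) (moved-π u)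
  σ′-at-gk : proj₁ σ′ (g k) ≡ just v
  σ′-at-gk = subst (λ j → proj₁ σ′ (g j) ≡ just v) (sym (position-unique σ v k σk≡v)) (moved-σ v)

-- triangle n = 0 + 1 + ... + (n-1), the number of pairs i < j in Fin n.
triangle : ℕ → ℕ
triangle zero    = 0
triangle (suc n) = n + triangle n

-- Pascal's rule with n C 1 = n gives the same recursion for n C 2.
C2≡triangle : (n : ℕ) → n C 2 ≡ triangle n
C2≡triangle zero    = refl
C2≡triangle (suc n) =
  trans (sym (nCk+nC[k+1]≡[n+1]C[k+1] n 1)) (cong₂ _+_ (nC1≡n n) (C2≡triangle n))

pair : (n : ℕ) → Fin (triangle n) → Fin n × Fin n
pair (suc n) k = [ (λ j → zero , suc j) , (λ k′ → Product.map suc suc (pair n k′)) ]′ (splitAt n k)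

Increasing : {n : ℕ} → Fin n × Fin n → Set
Increasing (i , j) = toℕ i < toℕ j

pair-increasing : (n : ℕ) (k : Fin (triangle n)) → Increasing (pair n k)
pair-increasing (suc n) k with splitAt n k
... | inj₁ j  = s≤s z≤n
... | inj₂ k′ = s≤s (pair-increasing n k′)

copair-injective : {A B C : Set} {f : A → C} {g : B → C} →
  Injective _≡_ _≡_ f → Injective _≡_ _≡_ g → (∀ x y → f x ≢ g y) →
  Injective _≡_ _≡_ [ f , g ]′
copair-injective f-inj g-inj disjoint {inj₁ x} {inj₁ x′} e = cong inj₁ (f-inj e)
copair-injective f-inj g-inj disjoint {inj₁ x} {inj₂ y′} e = ⊥-elim (disjoint x y′ e)
copair-injective f-inj g-inj disjoint {inj₂ y} {inj₁ x′} e = ⊥-elim (disjoint x′ y (sym e))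
copair-injective f-inj g-inj disjoint {inj₂ y} {inj₂ y′} e = cong inj₂ (g-inj e)

splitAt-injective : (m n : ℕ) → Injective _≡_ _≡_ (splitAt m {n})
splitAt-injective m n {k} {k′} e =
  trans (sym (join-splitAt m n k)) (trans (cong (join m n) e) (join-splitAt m n k′))

pair-injective : (n : ℕ) → Injective _≡_ _≡_ (pair n)
pair-injective (suc n) e =
  splitAt-injective n (triangle n)
    (copair-injective (suc-injective ∘ cong proj₂)
                      (pair-injective n ∘ shifted-injective)
                      (λ _ _ ()) e)
  where
  shifted-injective : {q r : Fin n × Fin n} → Product.map suc suc q ≡ Product.map suc suc r → q ≡ r
  shifted-injective e′ = cong₂ _,_ (suc-injective (cong proj₁ e′)) (suc-injective (cong proj₂ e′))

UnorderedEq : {A : Set} → A × A → A × A → Set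
UnorderedEq q r = q ≡ r ⊎ q ≡ swap r

unorderedEq? : {n : ℕ} (q r : Fin n × Fin n) → Dec (UnorderedEq q r)
unorderedEq? q r = ≡-dec _≟_ _≟_ q r ⊎-dec ≡-dec _≟_ _≟_ q (swap r)

-- A swap reverses the order, so no enumerated pair is the swap of another.
pair-not-reversed : (n : ℕ) (k k′ : Fin (triangle n)) → pair n k ≢ swap (pair n k′)
pair-not-reversed n k k′ e = <-asym (subst Increasing e (pair-increasing n k)) (pair-increasing n k′)

pair-unordered-injective : (n : ℕ) {k k′ : Fin (triangle n)} {r : Fin n × Fin n} →
  UnorderedEq (pair n k) r → UnorderedEq (pair n k′) r → k ≡ k′
pair-unordered-injective n (inj₁ e) (inj₁ e′) = pair-injective n (trans e (sym e′))
pair-unordered-injective n (inj₂ e) (inj₂ e′) = pair-injective n (trans e (sym e′))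
pair-unordered-injective n {k} {k′} (inj₁ e) (inj₂ e′) =
  ⊥-elim (pair-not-reversed n k k′ (trans e (sym (cong swap e′))))
pair-unordered-injective n {k} {k′} (inj₂ e) (inj₁ e′) =
  ⊥-elim (pair-not-reversed n k′ k (trans e′ (sym (cong swap e))))

pair-distinct : (n : ℕ) (k : Fin (triangle n)) → proj₁ (pair n k) ≢ proj₂ (pair n k)
pair-distinct n k e = <-irrefl (cong toℕ e) (pair-increasing n k)

unmatched : {m p : ℕ} (R : Fin m → Fin p → Set) → (∀ k i → Dec (R k i)) →
  (∀ {k k′ i} → R k i → R k′ i → k ≡ k′) → p < m → ∃[ k ] ∀ i → ¬ R k i
unmatched {m} {p} R R? functional p<m with all? (λ k → any? (R? k))
... | yes matched = ⊥-elim (collision (pigeonhole p<m (proj₁ ∘ matched)))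
  where
  collision : ∃[ k ] ∃[ k′ ] (k <ᶠ k′ × proj₁ (matched k) ≡ proj₁ (matched k′)) → ⊥
  collision (k , k′ , k<k′ , same) =
    <-irrefl (cong toℕ (functional (proj₂ (matched k)) (subst (R k′) (sym same) (proj₂ (matched k′))))) k<k′
... | no ¬matched with ¬∀⟶∃¬ m _ (λ k → any? (R? k)) ¬matched
... | k , none = k , λ i r → none (i , r)

module Glue {m : ℕ} (a a′ : Fin (suc m)) (a≢a′ : a ≢ a′) where

  glueAt : (u : Fin (suc m)) → Dec (u ≡ a′) → Fin m
  glueAt u (yes _)   = punchOut (a≢a′ ∘ sym)
  glueAt u (no u≢a′) = punchOut (u≢a′ ∘ sym)

  -- Remove slot a′ (punchOut) and send a′ itself to the image of a.
  glue : Fin (suc m) → Fin m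
  glue u = glueAt u (u ≟ a′)

  glue-collision : {u w : Fin (suc m)} → u ≢ w → glue u ≡ glue w → UnorderedEq (a , a′) (u , w)
  glue-collision {u} {w} u≢w e with u ≟ a′ | w ≟ a′
  ... | yes u≡a′ | yes w≡a′ = ⊥-elim (u≢w (trans u≡a′ (sym w≡a′)))
  ... | yes u≡a′ | no w≢a′  =
    inj₂ (cong₂ _,_ (punchOut-injective (a≢a′ ∘ sym) (w≢a′ ∘ sym) e) (sym u≡a′))
  ... | no u≢a′  | yes w≡a′ =
    inj₁ (cong₂ _,_ (punchOut-injective (a≢a′ ∘ sym) (u≢a′ ∘ sym) (sym e)) (sym w≡a′))
  ... | no u≢a′  | no w≢a′  = ⊥-elim (u≢w (punchOut-injective (u≢a′ ∘ sym) (w≢a′ ∘ sym) e))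

  glue-injective : {n : ℕ} (e : Fin n → Fin (suc m)) → Injective _≡_ _≡_ e →
    (∀ v w → (a , a′) ≢ (e v , e w)) → Injective _≡_ _≡_ (glue ∘ e)
  glue-injective e e-inj avoids {v} {w} glued with e v ≟ e w
  ... | yes same = e-inj same
  ... | no apart with glue-collision apart glued
  ...   | inj₁ hit = ⊥-elim (avoids v w hit)
  ...   | inj₂ hit = ⊥-elim (avoids w v hit)

avoids-slots : {A : Set} {q : A × A} (s : Fin 2 → A) → proj₁ q ≢ proj₂ q →
  ¬ UnorderedEq q (s zero , s (suc zero)) → ∀ v w → q ≢ (s v , s w)
avoids-slots s distinct unused zero       zero       e = distinct (trans (cong proj₁ e) (sym (cong proj₂ e)))
avoids-slots s distinct unused zero       (suc zero) e = unused (inj₁ e)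
avoids-slots s distinct unused (suc zero) zero       e = unused (inj₂ e)
avoids-slots s distinct unused (suc zero) (suc zero) e = distinct (trans (cong proj₁ e) (sym (cong proj₂ e)))

lemma6 : (b : ℕ) → (p : ℕ) → (π : Fin p → PermBlanks 2 (suc b)) → p < (suc b + 2) C 2 → Σ (Fin p → PermBlanks 2 b) (λ π′ → (i j : Fin p) → GDifferent M2 (π i) (π j) → GDifferent M2 (π′ i) (π′ j))
lemma6 b p π p<C = π′ , λ i j → relabel-preserves M2 {π i} {π j} {π′ i} {π′ j} glue (moved i) (moved j)
  where
  c : ℕ
  c = 2 + suc b
  slots : Fin p → Fin c × Fin c
  slots i = position (π i) zero , position (π i) (suc zero)
  p<triangle : p < triangle c
  p<triangle = subst (p <_) (trans (C2≡triangle (suc b + 2)) (cong triangle (+-comm (suc b) 2))) p<C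
  free : ∃[ k ] ∀ i → ¬ UnorderedEq (pair c k) (slots i)
  free = unmatched (λ k i → UnorderedEq (pair c k) (slots i)) (λ k i → unorderedEq? _ _)
                   (pair-unordered-injective c) p<triangle
  k : Fin (triangle c)
  k = proj₁ free
  open Glue (proj₁ (pair c k)) (proj₂ (pair c k)) (pair-distinct c k)
  -- Gluing keeps the two slots of each π i apart, since {a, a′} is unused.
  glued-injective : (i : Fin p) → Injective _≡_ _≡_ (glue ∘ position (π i))
  glued-injective i = glue-injective (position (π i)) (position-injective (π i))
                        (avoids-slots (position (π i)) (pair-distinct c k) (proj₂ free i))
  π′ : Fin p → PermBlanks 2 b
  π′ i = fromPositions (glue ∘ position (π i)) (glued-injective i)
  moved : (i : Fin p) (v : Fin 2) → proj₁ (π′ i) (glue (position (π i) v)) ≡ just v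
  moved i = placement-spec (glue ∘ position (π i)) (glued-injective i)
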